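{- Let $G$ be a graph of size $m$. Then $$d(G)\leq\frac12+\sqrt{\frac14+\frac{2m}{\gamma(G)}},$$ with equality if and only if $G$ is an $r$-partite graph with partite sets $H_1,\dots,H_r$ such that, for each $1\leq i\neq j\leq r$, the edge set of $G[H_i\cup H_j]$ is a perfect matching.
   Context: $\gamma(G)$ is the domination number (minimum size of a set $S$ such that every vertex outside $S$ has a neighbor in $S$). A domatic partition is a partition of $V(G)$ into dominating sets, and the domatic number $d(G)$ is the maximum number of parts in such a partition. $G[S]$ denotes the subgraph induced by $S$. -}

module Defs where

open import Data.Nat using (ℕ; zero; suc; _+_; _*_; _≤_)
open import Data.Bool using (Bool; true; false; if_then_else_; _∧_)
open import Data.Fin using (Fin; toℕ)
open import Data.Fin.Subset using (Subset; _∈_; ∣_∣)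
open import Data.List using (List; map; allFin)
open import Data.Nat.ListAction using (sum)
open import Data.Product using (Σ; ∃; ∃!; _×_; _,_)
open import Relation.Nullary using (¬_)
open import Data.Sum using (_⊎_)
open import Relation.Binary.PropositionalEquality using (_≡_)
open import Relation.Nullary.Decidable using (⌊_⌋)
import Data.Nat as ℕ

record Graph (n : ℕ) : Set where
  field
    Adj    : Fin n → Fin n → Bool
    sym    : ∀ u v → Adj u v ≡ Adj v u
    irrefl : ∀ v → Adj v v ≡ false
open Graph public

size : ∀ {n} → Graph n → ℕ
size {n} G =
  sum (map (λ u → sum (map (λ v →
        if ⌊ toℕ u ℕ.<? toℕ v ⌋ ∧ Adj G u v then 1 else 0)
      (allFin n))) (allFin n))

Dominating : ∀ {n} → Graph n → Subset n → Set
Dominating {n} G S = ∀ (v : Fin n) → v ∈ S ⊎ ∃ λ u → u ∈ S × Adj G u v ≡ true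

IsDominationNumber : ∀ {n} → Graph n → ℕ → Set
IsDominationNumber G k =
  (Σ _ λ S → Dominating G S × ∣ S ∣ ≡ k) ×
  (∀ S → Dominating G S → k ≤ ∣ S ∣)

-- a domatic partition into k parts: f assigns each vertex its part,
-- and every part  f⁻¹(c)  is a dominating set (hence nonempty when n ≥ 1)
Part : ∀ {n k} → (Fin n → Fin k) → Fin k → Subset n
Part f c = Data.Vec.tabulate (λ v → ⌊ f v Data.Fin.≟ c ⌋)
  where import Data.Vec; import Data.Fin

IsDomaticPartition : ∀ {n} → Graph n → (k : ℕ) → (Fin n → Fin k) → Set
IsDomaticPartition G k f = ∀ c → Dominating G (Part f c)

IsDomaticNumber : ∀ {n} → Graph n → ℕ → Set
IsDomaticNumber {n} G k =
  (Σ (Fin n → Fin k) λ f → IsDomaticPartition G k f) ×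
  (∀ j (f : Fin n → Fin j) → IsDomaticPartition G j f → j ≤ k)

-- G is r-partite with partite sets H_c = p⁻¹(c) (c : Fin r), and for all
-- i ≠ j the edge set of G[H_i ∪ H_j] is a perfect matching: every vertex of
-- H_i ∪ H_j is adjacent to exactly one vertex of H_i ∪ H_j.
InUnion : ∀ {n r} → (Fin n → Fin r) → Fin r → Fin r → Fin n → Set
InUnion p i j v = p v ≡ i ⊎ p v ≡ j

PerfectMatchingMultipartite : ∀ {n} → Graph n → (r : ℕ) → (Fin n → Fin r) → Set
PerfectMatchingMultipartite {n} G r p =
  (∀ u v → p u ≡ p v → Adj G u v ≡ false) ×
  (∀ i j → ¬ (i ≡ j) → ∀ v → InUnion p i j v →
     ∃! _≡_ λ u → InUnion p i j u × Adj G v u ≡ true)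

{-# OPTIONS --safe #-}
module Submission where

-- Let f be a domatic partition of G into d parts. Every part dominates G, so it has at least
-- γ vertices and dγ ≤ n; and every vertex v has a neighbour in each of the d − 1 parts other
-- than its own, so deg v ≥ d − 1 and 2m ≥ n(d − 1) ≥ γd(d − 1).
-- Equality forces every vertex to have no neighbour in its own part and exactly one in each
-- other part, which is the perfect-matching condition for the partite sets f⁻¹(c).
-- Conversely, for such a partition into r parts G is (r − 1)-regular, so 2m = n(r − 1); a
-- dominating set covers all n vertices by closed neighbourhoods of r vertices each, so
-- n ≤ γr; and the partite sets dominate, so r ≤ d. Hence 2m ≤ γd(d − 1).

open import Defs hiding (sym)
open import Data.Nat using (ℕ; zero; suc; _+_; _*_; _∸_; _≤_; _<_; _<?_; z≤n; s≤s)
open import Data.Nat.Properties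
  using ( +-*-semiring; ≤-refl; ≤-reflexive; ≤-trans; ≤-antisym; <-irrefl; <-asym; ≮⇒≥
        ; module ≤-Reasoning; m≤m+n; m≤n+m; +-comm; +-identityʳ; +-mono-≤; +-monoˡ-≤; +-monoʳ-≤
        ; +-cancelˡ-≤; +-cancelʳ-≤; m+n≡0⇒m≡0; m+n≡0⇒n≡0; *-comm; *-assoc; *-identityʳ
        ; *-mono-≤; *-monoˡ-≤; *-monoʳ-≤; ∸-monoˡ-≤; suc-pred)
open import Data.Bool using (Bool; true; false; if_then_else_; _∧_; _∨_; not)
open import Data.Bool.Properties
  using (∧-conicalˡ; ∧-conicalʳ; ∧-identityʳ; ∧-zeroʳ; ∨-zeroʳ; ¬-not)
open import Data.Fin using (Fin; zero; suc; toℕ; _≟_)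
open import Data.Fin.Properties using (toℕ-injective; nonZeroIndex; 0≢1+n; suc-injective)
open import Data.Fin.Subset using (Subset; _∈_; ∣_∣)
open import Data.Vec using ([]; _∷_; lookup)
open import Data.Vec.Properties using (lookup∘tabulate; []=⇒lookup; lookup⇒[]=)
import Data.List as List
open import Data.Nat.ListAction using () renaming (sum to sumᴸ)
open import Algebra.Properties.Semiring.Sum +-*-semiring
  using (sum; sum-syntax; sum-cong-≗; ∑-comm; ∑-distrib-+; *-distribʳ-sum)
open import Data.Product using (Σ; ∃; ∃!; _×_; _,_; map; map₁)
open import Data.Sum using (inj₁; inj₂; swap)
open import Function using (id; _∘_; _⇔_; mk⇔; Equivalence)
open import Relation.Nullary using (¬_; Dec; yes; no; contradiction)
open import Relation.Nullary.Decidable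
  using (⌊_⌋; isYes≗does; dec-true; dec-false; decidable-stable)
open import Relation.Binary.PropositionalEquality
  using (_≡_; _≢_; refl; sym; trans; cong; cong₂; subst; module ≡-Reasoning)

open Equivalence using (to; from)

𝟙 : Bool → ℕ
𝟙 b = if b then 1 else 0

true⇒1≤𝟙 : ∀ {b} → b ≡ true → 1 ≤ 𝟙 b
true⇒1≤𝟙 refl = ≤-refl

𝟙≡0⇒false : ∀ {b} → 𝟙 b ≡ 0 → b ≡ false
𝟙≡0⇒false {false} _ = refl

𝟙+𝟙-not : ∀ b → 𝟙 b + 𝟙 (not b) ≡ 1
𝟙+𝟙-not true  = refl
𝟙+𝟙-not false = refl

𝟙-∨ : ∀ a b → 𝟙 (a ∨ b) ≤ 𝟙 a + 𝟙 b
𝟙-∨ true  _ = s≤s z≤n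
𝟙-∨ false _ = ≤-refl

isYes⇒ : ∀ {P : Set} (P? : Dec P) → ⌊ P? ⌋ ≡ true → P
isYes⇒ (yes p) _ = p

⇒isYes : ∀ {P : Set} (P? : Dec P) → P → ⌊ P? ⌋ ≡ true
⇒isYes P? p = trans (isYes≗does P?) (dec-true P? p)

⇒isNo : ∀ {P : Set} (P? : Dec P) → ¬ P → ⌊ P? ⌋ ≡ false
⇒isNo P? ¬p = trans (isYes≗does P?) (dec-false P? ¬p)

∃!-map : ∀ {A : Set} {P Q : A → Set} → (∀ {x} → P x → Q x) → (∀ {x} → Q x → P x) →
         ∃! _≡_ P → ∃! _≡_ Q
∃!-map P⇒Q Q⇒P (x , px , unique) = x , P⇒Q px , λ qy → unique (Q⇒P qy)

sum-const : ∀ n x → ∑[ i < n ] x ≡ n * x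
sum-const zero    x = refl
sum-const (suc n) x = cong (x +_) (sum-const n x)

sum-mono-≤ : ∀ {n} {f g : Fin n → ℕ} → (∀ i → f i ≤ g i) → sum f ≤ sum g
sum-mono-≤ {zero}  f≤g = z≤n
sum-mono-≤ {suc n} f≤g = +-mono-≤ (f≤g zero) (sum-mono-≤ (f≤g ∘ suc))

sum-mono-≤-tight : ∀ {n} {f g : Fin n → ℕ} → (∀ i → f i ≤ g i) → sum g ≤ sum f →
                   ∀ i → f i ≡ g i
sum-mono-≤-tight {suc n} {f} {g} f≤g Σg≤Σf zero    = ≤-antisym (f≤g zero) g₀≤f₀
  where
  g₀≤f₀ : g zero ≤ f zero
  g₀≤f₀ = +-cancelʳ-≤ _ _ _
            (≤-trans Σg≤Σf (+-monoʳ-≤ (f zero) (sum-mono-≤ (f≤g ∘ suc))))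
sum-mono-≤-tight {suc n} {f} {g} f≤g Σg≤Σf (suc i) =
  sum-mono-≤-tight (f≤g ∘ suc) Σg′≤Σf′ i
  where
  Σg′≤Σf′ : sum (g ∘ suc) ≤ sum (f ∘ suc)
  Σg′≤Σf′ = +-cancelˡ-≤ (g zero) _ _ (≤-trans Σg≤Σf (+-monoˡ-≤ _ (f≤g zero)))

lookup≤sum : ∀ {n} (f : Fin n → ℕ) i → f i ≤ sum f
lookup≤sum f zero    = m≤m+n _ _
lookup≤sum f (suc i) = ≤-trans (lookup≤sum (f ∘ suc) i) (m≤n+m _ _)

lookup+lookup≤sum : ∀ {n} (f : Fin n → ℕ) {i j} → i ≢ j → f i + f j ≤ sum f
lookup+lookup≤sum f {zero}  {zero}  i≢j = contradiction refl i≢j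
lookup+lookup≤sum f {zero}  {suc j} _   = +-monoʳ-≤ (f zero) (lookup≤sum (f ∘ suc) j)
lookup+lookup≤sum f {suc i} {zero}  _   =
  ≤-trans (≤-reflexive (+-comm (f (suc i)) (f zero)))
          (+-monoʳ-≤ (f zero) (lookup≤sum (f ∘ suc) i))
lookup+lookup≤sum f {suc i} {suc j} i≢j =
  ≤-trans (lookup+lookup≤sum (f ∘ suc) (i≢j ∘ cong suc)) (m≤n+m _ _)

∑𝟙-positive : ∀ {n} (b : Fin n → Bool) → 0 < ∑[ i < n ] 𝟙 (b i) →
              ∃ λ i → b i ≡ true
∑𝟙-positive {suc n} b pos with b zero in b₀
... | true  = zero , b₀
... | false = map suc id (∑𝟙-positive (b ∘ suc) pos)

∑𝟙≡0⇔allFalse : ∀ {n} (b : Fin n → Bool) →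
                ∑[ i < n ] 𝟙 (b i) ≡ 0 ⇔ (∀ i → b i ≡ false)
∑𝟙≡0⇔allFalse b = mk⇔ (allFalse b) (∑≡0 b)
  where
  allFalse : ∀ {n} (b : Fin n → Bool) → ∑[ i < n ] 𝟙 (b i) ≡ 0 → ∀ i → b i ≡ false
  allFalse b Σ≡0 zero    = 𝟙≡0⇒false (m+n≡0⇒m≡0 _ Σ≡0)
  allFalse b Σ≡0 (suc i) = allFalse (b ∘ suc) (m+n≡0⇒n≡0 _ Σ≡0) i
  ∑≡0 : ∀ {n} (b : Fin n → Bool) → (∀ i → b i ≡ false) → ∑[ i < n ] 𝟙 (b i) ≡ 0
  ∑≡0 {zero}  b _      = refl
  ∑≡0 {suc n} b false! = cong₂ _+_ (cong 𝟙 (false! zero)) (∑≡0 (b ∘ suc) (false! ∘ suc))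

∑𝟙≡1⇔∃! : ∀ {n} (b : Fin n → Bool) →
           ∑[ i < n ] 𝟙 (b i) ≡ 1 ⇔ ∃! _≡_ (λ i → b i ≡ true)
∑𝟙≡1⇔∃! b = mk⇔ (exactlyOne b) (∑≡1 b)
  where
  exactlyOne : ∀ {n} (b : Fin n → Bool) → ∑[ i < n ] 𝟙 (b i) ≡ 1 →
               ∃! _≡_ (λ i → b i ≡ true)
  exactlyOne b Σ≡1 with ∑𝟙-positive b (≤-reflexive (sym Σ≡1))
  ... | i , bᵢ = i , bᵢ , λ {j} bⱼ → decidable-stable (i ≟ j) λ i≢j →
    <-irrefl refl (≤-trans (+-mono-≤ (true⇒1≤𝟙 bᵢ) (true⇒1≤𝟙 bⱼ))
                           (≤-trans (lookup+lookup≤sum (𝟙 ∘ b) i≢j) (≤-reflexive Σ≡1)))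
  ∑≡1 : ∀ {n} (b : Fin n → Bool) → ∃! _≡_ (λ i → b i ≡ true) →
        ∑[ i < n ] 𝟙 (b i) ≡ 1
  ∑≡1 b (zero , b₀ , unique) =
    cong₂ _+_ (cong 𝟙 b₀)
              (from (∑𝟙≡0⇔allFalse (b ∘ suc)) λ j → ¬-not λ bⱼ → 0≢1+n (unique bⱼ))
  ∑≡1 b (suc i , bᵢ , unique) =
    cong₂ _+_ (cong 𝟙 (¬-not λ b₀ → 0≢1+n (sym (unique b₀))))
              (∑≡1 (b ∘ suc) (i , bᵢ , λ bⱼ → suc-injective (unique bⱼ)))

∑𝟙≟≡1 : ∀ {k} (x : Fin k) → ∑[ c < k ] 𝟙 ⌊ x ≟ c ⌋ ≡ 1
∑𝟙≟≡1 x = from (∑𝟙≡1⇔∃! _) (x , ⇒isYes (x ≟ x) refl , λ {c} → isYes⇒ (x ≟ c))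

∑𝟙≢≡pred : ∀ {k} (x : Fin k) → ∑[ c < k ] 𝟙 (not ⌊ x ≟ c ⌋) ≡ k ∸ 1
∑𝟙≢≡pred {k} x = cong (_∸ 1) (begin
  1 + ∑≢                                        ≡⟨ cong (_+ ∑≢) (∑𝟙≟≡1 x) ⟨
  ∑[ c < k ] 𝟙 ⌊ x ≟ c ⌋ + ∑≢                   ≡⟨ ∑-distrib-+ {k} _ _ ⟨
  ∑[ c < k ] (𝟙 ⌊ x ≟ c ⌋ + 𝟙 (not ⌊ x ≟ c ⌋))
                                    ≡⟨ sum-cong-≗ {k} (λ c → 𝟙+𝟙-not ⌊ x ≟ c ⌋) ⟩
  ∑[ c < k ] 1                                  ≡⟨ sum-const k 1 ⟩
  k * 1                                         ≡⟨ *-identityʳ k ⟩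
  k                                             ∎)
  where
  open ≡-Reasoning
  ∑≢ : ℕ
  ∑≢ = ∑[ c < k ] 𝟙 (not ⌊ x ≟ c ⌋)

sumᴸ-map-tabulate : ∀ {A : Set} {n} (g : Fin n → A) (h : A → ℕ) →
                    sumᴸ (List.map h (List.tabulate g)) ≡ ∑[ i < n ] h (g i)
sumᴸ-map-tabulate {n = zero}  g h = refl
sumᴸ-map-tabulate {n = suc n} g h = cong (h (g zero) +_) (sumᴸ-map-tabulate (g ∘ suc) h)

∣p∣≡∑𝟙 : ∀ {n} (p : Subset n) → ∣ p ∣ ≡ ∑[ u < n ] 𝟙 (lookup p u)
∣p∣≡∑𝟙 []          = refl
∣p∣≡∑𝟙 (true ∷ p)  = cong suc (∣p∣≡∑𝟙 p)
∣p∣≡∑𝟙 (false ∷ p) = ∣p∣≡∑𝟙 p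

∈Part⇔ : ∀ {n k} {f : Fin n → Fin k} {c v} → v ∈ Part f c ⇔ f v ≡ c
∈Part⇔ {f = f} {c} {v} = mk⇔
  (λ v∈c → isYes⇒ (f v ≟ c) (trans (sym (lookup∘tabulate _ v)) ([]=⇒lookup v∈c)))
  (λ fv≡c → lookup⇒[]= v _ (trans (lookup∘tabulate _ v) (⇒isYes (f v ≟ c) fv≡c)))

∣Part∣≡∑𝟙 : ∀ {n k} (f : Fin n → Fin k) c →
            ∣ Part f c ∣ ≡ ∑[ v < n ] 𝟙 ⌊ f v ≟ c ⌋
∣Part∣≡∑𝟙 {n} f c =
  trans (∣p∣≡∑𝟙 (Part f c)) (sum-cong-≗ {n} λ v → cong 𝟙 (lookup∘tabulate _ v))

module _ {n : ℕ} (G : Graph n) where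

  deg : Fin n → ℕ
  deg v = ∑[ w < n ] 𝟙 (Adj G v w)

  handshake : 2 * size G ≡ ∑[ v < n ] deg v
  handshake = begin
    2 * size G                                         ≡⟨ cong (2 *_) size≡∑∑ ⟩
    2 * m                                              ≡⟨ cong (m +_) (+-identityʳ m) ⟩
    m + m                                              ≡⟨ cong (m +_) (∑-comm {n} {n} forward) ⟩
    m + ∑[ u < n ] ∑[ v < n ] forward v u              ≡⟨ ∑-distrib-+ {n} _ _ ⟨
    ∑[ u < n ] (∑[ v < n ] forward u v + ∑[ v < n ] forward v u)
                                               ≡⟨ sum-cong-≗ {n} (λ u → ∑-distrib-+ {n} _ _) ⟨
    ∑[ u < n ] ∑[ v < n ] (forward u v + forward v u)
                                               ≡⟨ sum-cong-≗ {n} (sum-cong-≗ {n} ∘ forward+backward) ⟩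
    ∑[ u < n ] deg u                                   ∎
    where
    open ≡-Reasoning
    forward : Fin n → Fin n → ℕ
    forward u v = 𝟙 (⌊ toℕ u <? toℕ v ⌋ ∧ Adj G u v)
    m : ℕ
    m = ∑[ u < n ] ∑[ v < n ] forward u v
    size≡∑∑ : size G ≡ m
    size≡∑∑ = trans (sumᴸ-map-tabulate {n = n} _ _)
                    (sum-cong-≗ {n} λ u → sumᴸ-map-tabulate {n = n} _ _)
    forward+backward : ∀ u v → forward u v + forward v u ≡ 𝟙 (Adj G u v)
    forward+backward u v with toℕ u <? toℕ v | toℕ v <? toℕ u
    ... | yes u<v | yes v<u = contradiction v<u (<-asym u<v)
    ... | yes _   | no _    = +-identityʳ _
    ... | no _    | yes _   = cong 𝟙 (Graph.sym G v u)
    ... | no u≮v  | no v≮u  with toℕ-injective (≤-antisym (≮⇒≥ v≮u) (≮⇒≥ u≮v))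
    ...   | refl = cong 𝟙 (sym (irrefl G u))

  degIn : ∀ {k} → (Fin n → Fin k) → Fin n → Fin k → ℕ
  degIn p v c = ∑[ w < n ] 𝟙 (Adj G v w ∧ ⌊ p w ≟ c ⌋)

  deg≡∑degIn : ∀ {k} (p : Fin n → Fin k) v → deg v ≡ ∑[ c < k ] degIn p v c
  deg≡∑degIn {k} p v = trans (sum-cong-≗ {n} split) (∑-comm {n} {k} _)
    where
    split : ∀ w → 𝟙 (Adj G v w) ≡ ∑[ c < k ] 𝟙 (Adj G v w ∧ ⌊ p w ≟ c ⌋)
    split w with Adj G v w
    ... | true  = sym (∑𝟙≟≡1 (p w))
    ... | false = sym (from (∑𝟙≡0⇔allFalse {k} λ _ → false) λ _ → refl)

  domatic⇒degIn≥ : ∀ {k f} → IsDomaticPartition G k f →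
                   ∀ v c → 𝟙 (not ⌊ f v ≟ c ⌋) ≤ degIn f v c
  domatic⇒degIn≥ {f = f} D v c with f v ≟ c
  ... | yes _    = z≤n
  ... | no fv≢c  with D c v
  ...   | inj₁ v∈c            = contradiction (to ∈Part⇔ v∈c) fv≢c
  ...   | inj₂ (u , u∈c , uv) = ≤-trans (true⇒1≤𝟙 vu∈c) (lookup≤sum _ u)
    where
    vu∈c : (Adj G v u ∧ ⌊ f u ≟ c ⌋) ≡ true
    vu∈c = cong₂ _∧_ (trans (Graph.sym G v u) uv) (⇒isYes (f u ≟ c) (to ∈Part⇔ u∈c))

  domatic⇒k∸1≤deg : ∀ {k f} → IsDomaticPartition G k f → ∀ v → k ∸ 1 ≤ deg v
  domatic⇒k∸1≤deg {k} {f} D v = begin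
    k ∸ 1                              ≡⟨ ∑𝟙≢≡pred (f v) ⟨
    ∑[ c < k ] 𝟙 (not ⌊ f v ≟ c ⌋)     ≤⟨ sum-mono-≤ (domatic⇒degIn≥ D v) ⟩
    ∑[ c < k ] degIn f v c             ≡⟨ deg≡∑degIn f v ⟨
    deg v                              ∎
    where open ≤-Reasoning

  domatic⇒k*γ≤n : ∀ {k f γ} → IsDomaticPartition G k f →
                  (∀ S → Dominating G S → γ ≤ ∣ S ∣) → k * γ ≤ n
  domatic⇒k*γ≤n {k} {f} {γ} D γ≤ = begin
    k * γ                                 ≡⟨ sum-const k γ ⟨
    ∑[ c < k ] γ                          ≤⟨ sum-mono-≤ (λ c → γ≤ (Part f c) (D c)) ⟩
    ∑[ c < k ] ∣ Part f c ∣               ≡⟨ sum-cong-≗ {k} (∣Part∣≡∑𝟙 f) ⟩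
    ∑[ c < k ] ∑[ v < n ] 𝟙 ⌊ f v ≟ c ⌋   ≡⟨ ∑-comm {k} {n} _ ⟩
    ∑[ v < n ] ∑[ c < k ] 𝟙 ⌊ f v ≟ c ⌋   ≡⟨ sum-cong-≗ {n} (∑𝟙≟≡1 ∘ f) ⟩
    ∑[ v < n ] 1                          ≡⟨ sum-const n 1 ⟩
    n * 1                                 ≡⟨ *-identityʳ n ⟩
    n                                     ∎
    where open ≤-Reasoning

  domatic⇒γ*[k*[k∸1]]≤n*[k∸1] : ∀ {k f γ} → IsDomaticPartition G k f →
                                (∀ S → Dominating G S → γ ≤ ∣ S ∣) →
                                γ * (k * (k ∸ 1)) ≤ n * (k ∸ 1)
  domatic⇒γ*[k*[k∸1]]≤n*[k∸1] {k} {f} {γ} D γ≤ = begin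
    γ * (k * (k ∸ 1))  ≡⟨ *-assoc γ k (k ∸ 1) ⟨
    γ * k * (k ∸ 1)    ≡⟨ cong (_* (k ∸ 1)) (*-comm γ k) ⟩
    k * γ * (k ∸ 1)    ≤⟨ *-monoˡ-≤ (k ∸ 1) (domatic⇒k*γ≤n D γ≤) ⟩
    n * (k ∸ 1)        ∎
    where open ≤-Reasoning

  domatic⇒n*[k∸1]≤2*size : ∀ {k f} → IsDomaticPartition G k f → n * (k ∸ 1) ≤ 2 * size G
  domatic⇒n*[k∸1]≤2*size {k} D = begin
    n * (k ∸ 1)           ≡⟨ sum-const n (k ∸ 1) ⟨
    ∑[ v < n ] (k ∸ 1)    ≤⟨ sum-mono-≤ (domatic⇒k∸1≤deg D) ⟩
    ∑[ v < n ] deg v      ≡⟨ handshake ⟨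
    2 * size G            ∎
    where open ≤-Reasoning

  -- The indicator also says that v has no neighbour in its own part p v.
  OneNeighbourInEachOtherPart : ∀ {k} → (Fin n → Fin k) → Set
  OneNeighbourInEachOtherPart p = ∀ v c → degIn p v c ≡ 𝟙 (not ⌊ p v ≟ c ⌋)

  domatic-tight⇒oneNeighbour : ∀ {k f} → IsDomaticPartition G k f →
                               2 * size G ≤ n * (k ∸ 1) → OneNeighbourInEachOtherPart f
  domatic-tight⇒oneNeighbour {k} {f} D 2m≤ v c =
    sym (sum-mono-≤-tight (domatic⇒degIn≥ D v) ∑degIn≤ c)
    where
    ∑deg≤ : ∑[ u < n ] deg u ≤ ∑[ u < n ] (k ∸ 1)
    ∑deg≤ = begin
      ∑[ u < n ] deg u    ≡⟨ handshake ⟨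
      2 * size G          ≤⟨ 2m≤ ⟩
      n * (k ∸ 1)         ≡⟨ sum-const n (k ∸ 1) ⟨
      ∑[ u < n ] (k ∸ 1)  ∎
      where open ≤-Reasoning
    ∑degIn≤ : ∑[ c < k ] degIn f v c ≤ ∑[ c < k ] 𝟙 (not ⌊ f v ≟ c ⌋)
    ∑degIn≤ = ≤-reflexive (begin
      ∑[ c < k ] degIn f v c          ≡⟨ deg≡∑degIn f v ⟨
      deg v                           ≡⟨ sum-mono-≤-tight (domatic⇒k∸1≤deg D) ∑deg≤ v ⟨
      k ∸ 1                           ≡⟨ ∑𝟙≢≡pred (f v) ⟨
      ∑[ c < k ] 𝟙 (not ⌊ f v ≟ c ⌋)  ∎)
      where open ≡-Reasoning

  module _ {r} {p : Fin n → Fin r}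
           (noEdgeInPart : ∀ u v → p u ≡ p v → Adj G u v ≡ false) where

    neighbourInUnion⇔ : ∀ {v c} → p v ≢ c → ∀ {w} →
                        (InUnion p (p v) c w × Adj G v w ≡ true) ⇔
                        (Adj G v w ∧ ⌊ p w ≟ c ⌋) ≡ true
    neighbourInUnion⇔ {v} {c} pv≢c {w} = mk⇔ inUnion⇒ ⇒inUnion
      where
      inUnion⇒ : InUnion p (p v) c w × Adj G v w ≡ true → (Adj G v w ∧ ⌊ p w ≟ c ⌋) ≡ true
      inUnion⇒ (inj₁ pw≡pv , vw) =
        contradiction (trans (sym vw) (noEdgeInPart v w (sym pw≡pv))) λ ()
      inUnion⇒ (inj₂ pw≡c  , vw) = cong₂ _∧_ vw (⇒isYes (p w ≟ c) pw≡c)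
      ⇒inUnion : (Adj G v w ∧ ⌊ p w ≟ c ⌋) ≡ true → InUnion p (p v) c w × Adj G v w ≡ true
      ⇒inUnion vw∈c = inj₂ (isYes⇒ (p w ≟ c) (∧-conicalʳ _ _ vw∈c)) , ∧-conicalˡ _ _ vw∈c

    uniqueNeighbourInUnion⇔degIn≡1 : ∀ {v c} → p v ≢ c →
      (∃! _≡_ λ w → InUnion p (p v) c w × Adj G v w ≡ true) ⇔ degIn p v c ≡ 1
    uniqueNeighbourInUnion⇔degIn≡1 {v} {c} pv≢c = mk⇔
      (from (∑𝟙≡1⇔∃! _) ∘ ∃!-map (to inUnion⇔) (from inUnion⇔))
      (∃!-map (from inUnion⇔) (to inUnion⇔) ∘ to (∑𝟙≡1⇔∃! _))
      where
      inUnion⇔ : ∀ {w} → (InUnion p (p v) c w × Adj G v w ≡ true) ⇔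
                         (Adj G v w ∧ ⌊ p w ≟ c ⌋) ≡ true
      inUnion⇔ = neighbourInUnion⇔ pv≢c

    noNeighbourInOwnPart : ∀ {v c} → p v ≡ c → degIn p v c ≡ 0
    noNeighbourInOwnPart {v} {c} pv≡c = from (∑𝟙≡0⇔allFalse _) noEdge
      where
      noEdge : ∀ w → (Adj G v w ∧ ⌊ p w ≟ c ⌋) ≡ false
      noEdge w with p w ≟ c
      ... | yes pw≡c = trans (∧-identityʳ _) (noEdgeInPart v w (trans pv≡c (sym pw≡c)))
      ... | no _     = ∧-zeroʳ _

  pmm⇔oneNeighbour : ∀ {r} {p : Fin n → Fin r} →
                     PerfectMatchingMultipartite G r p ⇔ OneNeighbourInEachOtherPart p
  pmm⇔oneNeighbour {r} {p} = mk⇔ pmm⇒ ⇒pmm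
    where
    pmm⇒ : PerfectMatchingMultipartite G r p → OneNeighbourInEachOtherPart p
    pmm⇒ (noEdgeInPart , matching) v c with p v ≟ c
    ... | yes pv≡c = noNeighbourInOwnPart noEdgeInPart pv≡c
    ... | no pv≢c  = to (uniqueNeighbourInUnion⇔degIn≡1 noEdgeInPart pv≢c)
                        (matching (p v) c pv≢c v (inj₁ refl))

    ⇒pmm : OneNeighbourInEachOtherPart p → PerfectMatchingMultipartite G r p
    ⇒pmm exact = noEdgeInPart , matching
      where
      noEdgeInPart : ∀ u v → p u ≡ p v → Adj G u v ≡ false
      noEdgeInPart u v pu≡pv = trans (sym (∧-identityʳ _))
        (subst (λ b → (Adj G u v ∧ b) ≡ false) (⇒isYes (p v ≟ p u) (sym pu≡pv))
               (to (∑𝟙≡0⇔allFalse _) noneInOwnPart v))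
        where
        noneInOwnPart : degIn p u (p u) ≡ 0
        noneInOwnPart = trans (exact u (p u)) (cong (𝟙 ∘ not) (⇒isYes (p u ≟ p u) refl))
      matchingFromOwnPart : ∀ v c → p v ≢ c →
                            ∃! _≡_ λ w → InUnion p (p v) c w × Adj G v w ≡ true
      matchingFromOwnPart v c pv≢c = from (uniqueNeighbourInUnion⇔degIn≡1 noEdgeInPart pv≢c)
        (trans (exact v c) (cong (𝟙 ∘ not) (⇒isNo (p v ≟ c) pv≢c)))
      matching : ∀ i j → i ≢ j → ∀ v → InUnion p i j v →
                 ∃! _≡_ λ w → InUnion p i j w × Adj G v w ≡ true
      matching i j i≢j v (inj₁ refl) = matchingFromOwnPart v j i≢j
      matching i j i≢j v (inj₂ refl) =
        ∃!-map (map₁ swap) (map₁ swap) (matchingFromOwnPart v i (i≢j ∘ sym))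

  module _ {r} {p : Fin n → Fin r} (exact : OneNeighbourInEachOtherPart p) where

    oneNeighbour⇒domatic : IsDomaticPartition G r p
    oneNeighbour⇒domatic c v with p v ≟ c | exact v c
    ... | yes pv≡c | _         = inj₁ (from ∈Part⇔ pv≡c)
    ... | no _     | degIn≡1 with ∑𝟙-positive _ (≤-reflexive (sym degIn≡1))
    ...   | w , vw∈c = inj₂ (w , from ∈Part⇔ (isYes⇒ (p w ≟ c) (∧-conicalʳ _ _ vw∈c))
                            , trans (Graph.sym G w v) (∧-conicalˡ _ _ vw∈c))

    oneNeighbour⇒deg≡r∸1 : ∀ v → deg v ≡ r ∸ 1
    oneNeighbour⇒deg≡r∸1 v =
      trans (deg≡∑degIn p v) (trans (sum-cong-≗ {r} (exact v)) (∑𝟙≢≡pred (p v)))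

    oneNeighbour⇒2*size≡n*[r∸1] : 2 * size G ≡ n * (r ∸ 1)
    oneNeighbour⇒2*size≡n*[r∸1] =
      trans handshake (trans (sum-cong-≗ {n} oneNeighbour⇒deg≡r∸1) (sum-const n (r ∸ 1)))

    oneNeighbour⇒1+deg≡r : ∀ v → suc (deg v) ≡ r
    oneNeighbour⇒1+deg≡r v =
      trans (cong suc (oneNeighbour⇒deg≡r∸1 v)) (suc-pred r {{nonZeroIndex (p v)}})

  dominating⇒n≤∣S∣*Δ : ∀ {S Δ} → Dominating G S → (∀ u → suc (deg u) ≤ Δ) →
                       n ≤ ∣ S ∣ * Δ
  dominating⇒n≤∣S∣*Δ {S} {Δ} D closedDeg≤ = begin
    n                                  ≡⟨ *-identityʳ n ⟨
    n * 1                              ≡⟨ sum-const n 1 ⟨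
    ∑[ w < n ] 1                       ≤⟨ sum-mono-≤ covered ⟩
    ∑[ w < n ] ∑[ u < n ] closed u w   ≡⟨ ∑-comm {n} {n} _ ⟩
    ∑[ u < n ] ∑[ w < n ] closed u w   ≤⟨ sum-mono-≤ row ⟩
    ∑[ u < n ] (𝟙 (lookup S u) * Δ)    ≡⟨ *-distribʳ-sum {n} Δ _ ⟨
    (∑[ u < n ] 𝟙 (lookup S u)) * Δ    ≡⟨ cong (_* Δ) (∣p∣≡∑𝟙 S) ⟨
    ∣ S ∣ * Δ                          ∎
    where
    open ≤-Reasoning
    closed : Fin n → Fin n → ℕ
    closed u w = 𝟙 (lookup S u ∧ (⌊ u ≟ w ⌋ ∨ Adj G u w))
    covered : ∀ w → 1 ≤ ∑[ u < n ] closed u w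
    covered w with D w
    ... | inj₁ w∈S            = ≤-trans (true⇒1≤𝟙 (cong₂ _∧_ ([]=⇒lookup w∈S)
                                  (cong (_∨ Adj G w w) (⇒isYes (w ≟ w) refl)))) (lookup≤sum _ w)
    ... | inj₂ (u , u∈S , uw) = ≤-trans (true⇒1≤𝟙 (cong₂ _∧_ ([]=⇒lookup u∈S)
                                  (trans (cong (⌊ u ≟ w ⌋ ∨_) uw) (∨-zeroʳ _)))) (lookup≤sum _ u)
    row : ∀ u → ∑[ w < n ] closed u w ≤ 𝟙 (lookup S u) * Δ
    row u with lookup S u
    ... | false = ≤-reflexive (from (∑𝟙≡0⇔allFalse {n} λ _ → false) λ _ → refl)
    ... | true  = begin
      ∑[ w < n ] 𝟙 (⌊ u ≟ w ⌋ ∨ Adj G u w)     ≤⟨ sum-mono-≤ (λ w → 𝟙-∨ _ (Adj G u w)) ⟩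
      ∑[ w < n ] (𝟙 ⌊ u ≟ w ⌋ + 𝟙 (Adj G u w))  ≡⟨ ∑-distrib-+ {n} _ _ ⟩
      ∑[ w < n ] 𝟙 ⌊ u ≟ w ⌋ + deg u            ≡⟨ cong (_+ deg u) (∑𝟙≟≡1 u) ⟩
      suc (deg u)                               ≤⟨ closedDeg≤ u ⟩
      Δ                                         ≡⟨ +-identityʳ Δ ⟨
      Δ + 0                                     ∎

  pmm⇒domatic : ∀ {r} {p : Fin n → Fin r} → PerfectMatchingMultipartite G r p →
                IsDomaticPartition G r p
  pmm⇒domatic = oneNeighbour⇒domatic ∘ to pmm⇔oneNeighbour

  pmm⇒2*size≤∣S∣*[r*[r∸1]] : ∀ {r} {p : Fin n → Fin r} {S} →
                              PerfectMatchingMultipartite G r p → Dominating G S →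
                              2 * size G ≤ ∣ S ∣ * (r * (r ∸ 1))
  pmm⇒2*size≤∣S∣*[r*[r∸1]] {r} {S = S} pmm D = begin
    2 * size G             ≡⟨ oneNeighbour⇒2*size≡n*[r∸1] exact ⟩
    n * (r ∸ 1)            ≤⟨ *-monoˡ-≤ (r ∸ 1) n≤∣S∣*r ⟩
    ∣ S ∣ * r * (r ∸ 1)    ≡⟨ *-assoc ∣ S ∣ r (r ∸ 1) ⟩
    ∣ S ∣ * (r * (r ∸ 1))  ∎
    where
    open ≤-Reasoning
    exact : OneNeighbourInEachOtherPart _
    exact = to pmm⇔oneNeighbour pmm
    n≤∣S∣*r : n ≤ ∣ S ∣ * r
    n≤∣S∣*r = dominating⇒n≤∣S∣*Δ D (≤-reflexive ∘ oneNeighbour⇒1+deg≡r exact)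

corollary1 : ∀ {n} (G : Graph n) → 1 ≤ n → (γ d : ℕ) →
    IsDominationNumber G γ → IsDomaticNumber G d →
    (γ * (d * (d ∸ 1)) ≤ 2 * size G) ×
    ((γ * (d * (d ∸ 1)) ≡ 2 * size G) ⇔
      Σ ℕ λ r → Σ (Fin n → Fin r) λ p → PerfectMatchingMultipartite G r p)
corollary1 {n} G _ γ d ((S , S-dominating , ∣S∣≡γ) , γ-minimal) ((f , f-domatic) , d-maximal) =
  bound , mk⇔ extremal⇒pmm pmm⇒extremal
  where
  γd[d∸1]≤n[d∸1] : γ * (d * (d ∸ 1)) ≤ n * (d ∸ 1)
  γd[d∸1]≤n[d∸1] = domatic⇒γ*[k*[k∸1]]≤n*[k∸1] G f-domatic γ-minimal
  bound : γ * (d * (d ∸ 1)) ≤ 2 * size G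
  bound = ≤-trans γd[d∸1]≤n[d∸1] (domatic⇒n*[k∸1]≤2*size G f-domatic)
  extremal⇒pmm : γ * (d * (d ∸ 1)) ≡ 2 * size G →
                 Σ ℕ λ r → Σ (Fin n → Fin r) λ p → PerfectMatchingMultipartite G r p
  extremal⇒pmm extremal = d , f , from (pmm⇔oneNeighbour G)
    (domatic-tight⇒oneNeighbour G f-domatic (≤-trans (≤-reflexive (sym extremal)) γd[d∸1]≤n[d∸1]))
  pmm⇒extremal : (Σ ℕ λ r → Σ (Fin n → Fin r) λ p → PerfectMatchingMultipartite G r p) →
                 γ * (d * (d ∸ 1)) ≡ 2 * size G
  pmm⇒extremal (r , p , pmm) = ≤-antisym bound (begin
    2 * size G             ≤⟨ pmm⇒2*size≤∣S∣*[r*[r∸1]] G pmm S-dominating ⟩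
    ∣ S ∣ * (r * (r ∸ 1))  ≡⟨ cong (_* (r * (r ∸ 1))) ∣S∣≡γ ⟩
    γ * (r * (r ∸ 1))      ≤⟨ *-monoʳ-≤ γ (*-mono-≤ r≤d (∸-monoˡ-≤ 1 r≤d)) ⟩
    γ * (d * (d ∸ 1))      ∎)
    where
    open ≤-Reasoning
    r≤d : r ≤ d
    r≤d = d-maximal r p (pmm⇒domatic G pmm)
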